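{- Let $q$ be a power of a prime $p$, $a\in\mathbb{F}_q$, $s$ an integer with $1<s<q$. For $j\in\mathbb{N}^*$ and $1\leq n\leq q^{j-1}+1$, the sequence $(d_{j,m,n})_{m\geq n}$ (defined in the context) is periodic.
   Context: For a word $w$ over $\{0,\dots,q-1\}$, $[w]_q$ is the integer whose base-$q$ expansion is $w$, and $x^m$ denotes $m$ copies of the letter $x$ (so $[1^00]_q=0$); $\bar{s}=q-s$. Decomposition procedure: given a positive integer $b$, set $b_1=b$. Inductively, if $b_i$ has been defined and $b_i\ge q-1$, let $l_i=\max\{l\in\mathbb{N}^*: b_i\geq q^l-1\}$; if $b_i-(q^{l_i}-1)>[1^{l_i-1}0]_q$ the procedure stops, otherwise set $b_{i+1}=b_i-(q^{l_i}-1)$ and continue. If $b_i<q-1$ the procedure stops. For $j,m\in\mathbb{N}^*$, $b_{j,m,n}$ is the term $b_n$ produced with input $b_1=[1^m0^j]_q$ (undefined if the procedure stops before producing $b_n$). When $b_{j,m,n}$ is defined and there is $k\in\mathbb{N}$ with $[\bar{s}^k]_q\le b_{j,m,n}\le[1^k0]_q$, set $k_{j,m,n}=k$ and $c_{j,m,n}=b_{j,m,n}-[\bar{s}^{k}]_q$, and define $d_{j,m,n}=(-1)^{k_{j,m,n}(s-1)}\binom{[s^{k_{j,m,n}}]_q}{c_{j,m,n}}(-a)^{c_{j,m,n}}(-1)^{n-1}\in\mathbb{F}_q$ (binomial coefficient taken mod $p$); otherwise $d_{j,m,n}=0$. -}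

module Defs where

open import Level using (_⊔_)
open import Algebra.Bundles using (CommutativeRing; Semiring)
open import Data.Nat using (ℕ; zero; suc; _+_; _*_; _∸_; _^_; _≤_; _≤?_)
open import Data.Nat.Combinatorics using (_C_)
open import Data.Fin using (Fin)
open import Data.Maybe using (Maybe; just; nothing; _>>=_)
open import Data.Product using (∃)
open import Relation.Nullary using (¬_; yes; no)
open import Relation.Binary.PropositionalEquality using (_≡_)
import Algebra.Definitions.RawSemiring as RawSemiringDefs

record IsFiniteFieldOfOrder {c ℓ} (R : CommutativeRing c ℓ) (q : ℕ) : Set (c ⊔ ℓ) where
  open CommutativeRing R using (Carrier; _≈_; 0#; 1#) renaming (_*_ to _·_)
  field
    0≉1       : ¬ (0# ≈ 1#)
    inverse   : ∀ x → ¬ (x ≈ 0#) → ∃ λ y → x · y ≈ 1#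
    enum      : Fin q → Carrier
    enum-surj : ∀ x → ∃ λ i → enum i ≈ x
    enum-inj  : ∀ i j → enum i ≈ enum j → i ≡ j

-- ones q l = [1^l]_q
ones : ℕ → ℕ → ℕ
ones q zero    = 0
ones q (suc l) = ones q l * q + 1

ones0 : ℕ → ℕ → ℕ
ones0 q l = ones q l * q

ones-zeros : ℕ → ℕ → ℕ → ℕ
ones-zeros q m j = ones q m * q ^ j

rep : ℕ → ℕ → ℕ → ℕ
rep q x k = x * ones q k

maxLUpTo : ℕ → ℕ → ℕ → ℕ
maxLUpTo q b zero    = 0
maxLUpTo q b (suc u) with q ^ suc u ∸ 1 ≤? b
... | yes _ = suc u
... | no  _ = maxLUpTo q b u

-- l = max{ l ≥ 1 : b ≥ q^l - 1 }.  For q ≥ 2 any such l satisfies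
-- l ≤ q^l - 1 ≤ b, so searching in {1,…,b} finds the maximum.
maxL : ℕ → ℕ → ℕ
maxL q b = maxLUpTo q b b

-- One step of the procedure: nothing = "the procedure stops".
-- Stop test: b - (q^l - 1) > [1^(l-1) 0]_q.
step : ℕ → ℕ → Maybe ℕ
step q b with q ∸ 1 ≤? b
... | no  _ = nothing
... | yes _ with b ∸ (q ^ maxL q b ∸ 1) ≤? ones0 q (maxL q b ∸ 1)
...   | no  _ = nothing
...   | yes _ = just (b ∸ (q ^ maxL q b ∸ 1))

-- bTerm q b n = b_n for input b_1 = b  (n ≥ 1; nothing = undefined).
bTerm : ℕ → ℕ → ℕ → Maybe ℕ
bTerm q b zero          = nothing
bTerm q b (suc zero)    = just b
bTerm q b (suc (suc n)) = bTerm q b (suc n) >>= step q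

bjmn : ℕ → ℕ → ℕ → ℕ → Maybe ℕ
bjmn q j m n = bTerm q (ones-zeros q m j) n

-- k with [s̄^k]_q ≤ b ≤ [1^k 0]_q (unique when it exists, since these
-- intervals are disjoint for 1 < s < q).  Any such k satisfies
-- k ≤ [s̄^k]_q ≤ b, so searching k ∈ {0,…,b} suffices.

findKUpTo : ℕ → ℕ → ℕ → ℕ → Maybe ℕ
findKUpTo q s b zero with rep q (q ∸ s) 0 ≤? b | b ≤? ones0 q 0
... | yes _ | yes _ = just 0
... | _     | _     = nothing
findKUpTo q s b (suc u) with rep q (q ∸ s) (suc u) ≤? b | b ≤? ones0 q (suc u)
... | yes _ | yes _ = just (suc u)
... | _     | _     = findKUpTo q s b u

findK : ℕ → ℕ → ℕ → Maybe ℕ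
findK q s b = findKUpTo q s b b

module _ {c ℓ} (R : CommutativeRing c ℓ) where
  open CommutativeRing R using (Carrier; 0#; 1#; -_; semiring) renaming (_*_ to _·_)
  open RawSemiringDefs (Semiring.rawSemiring semiring) using (_×_) renaming (_^_ to _^ᴿ_)

  dValue : (q s : ℕ) (a : Carrier) (n b k : ℕ) → Carrier
  dValue q s a n b k =
    let cc = b ∸ rep q (q ∸ s) k in
    (((- 1#) ^ᴿ (k * (s ∸ 1))) · (((rep q s k) C cc) × 1#))
      · (((- a) ^ᴿ cc) · ((- 1#) ^ᴿ (n ∸ 1)))

  -- d_{j,m,n}; the binomial coefficient is mapped into the field via
  -- N ↦ N·1, which is the same as reducing it mod p = char F_q.
  d : (q s : ℕ) (a : Carrier) (j m n : ℕ) → Carrier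
  d q s a j m n with bjmn q j m n
  ... | nothing = 0#
  ... | just b with findK q s b
  ...   | nothing = 0#
  ...   | just k  = dValue q s a n b k

-- Write q = r + 2, j = J + 1, n = i + 1 and m = i + M + 1.  If i ≤ [1^J 0]_q,
-- every step of the decomposition procedure on b_1 = [1^m 0^j]_q moves one
-- leading digit 1 into the tail, so b_n = [1^(M+1) 0^j]_q + i, its level is
-- k = M + J + 1, and c = [s^k]_q - ([1^J 0]_q - i)  (module Decomposition).
-- This makes d_(j,m,n) an explicit function of k (module Periodicity).
-- Raising m by T = q - 1 adds L = s·[1^T 0^k]_q to [s^k]_q.  Since q^j = p^(ej)
-- divides L and exceeds [1^J 0]_q, the binomial coefficient is unchanged mod p
-- (BinomialsModPrime, CharacteristicP); since q - 1 divides L and the sign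
-- exponent grows by a multiple of q - 1, the powers of -1 and -a are unchanged
-- by Fermat's little theorem x^q = x (FiniteFields, PeriodicPowers).  In the
-- one remaining case j = 1, n = 2 the procedure stops before b_2, so d = 0.
-- The general facts about repunits [1^l]_q come first (Repunits).

module Submission where

open import Defs
open import Algebra.Bundles using (CommutativeRing; Semiring)
open import Data.Nat.Base using (ℕ)

module Repunits where

  open import Data.Nat
  open import Data.Nat.Properties
  open import Data.Product using (∃; _,_)
  open import Relation.Binary.PropositionalEquality
  open import Data.Nat.Solver using (module +-*-Solver)
  open +-*-Solver

  ones-+ : ∀ q a b → ones q (a + b) ≡ ones q a * q ^ b + ones q b
  ones-+ q a zero rewrite +-identityʳ a = sym (trans (+-identityʳ _) (*-identityʳ _))
  ones-+ q a (suc b) rewrite +-suc a b | ones-+ q a b =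
    solve 4 (λ x y z w → (x :* y :+ z) :* w :+ con 1 := x :* (w :* y) :+ (z :* w :+ con 1))
      refl (ones q a) (q ^ b) (ones q b) q

  ones-suc : ∀ q l → ones q (suc l) ≡ q ^ l + ones q l
  ones-suc q l = trans (ones-+ q 1 l) (cong (_+ ones q l) (*-identityˡ (q ^ l)))

  ones0-+ : ∀ q M J → ones0 q (M + J) ≡ ones q M * q ^ suc J + ones q J * q
  ones0-+ q M J rewrite ones-+ q M J =
    solve 4 (λ a b c d → (a :* b :+ c) :* d := a :* (d :* b) :+ c :* d)
      refl (ones q M) (q ^ J) (ones q J) q

  ones-geometric : ∀ r l → ones (suc r) l * r + 1 ≡ suc r ^ l
  ones-geometric r zero = refl
  ones-geometric r (suc l) rewrite sym (ones-geometric r l) =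
    solve 2 (λ x y → (x :* (con 1 :+ y) :+ con 1) :* y :+ con 1 := (con 1 :+ y) :* (x :* y :+ con 1))
      refl (ones (suc r) l) r

  -- Each digit 1 is ≡ 1 modulo q-1, so [1^l]_q ≡ l (mod q-1).
  ones-≡-length : ∀ r l → ∃ λ w → ones (suc r) l ≡ l + r * w
  ones-≡-length r zero = 0 , sym (*-zeroʳ r)
  ones-≡-length r (suc l) with ones-≡-length r l
  ... | w , eq = w + ones (suc r) l , next (ones (suc r) l) eq
    where
    next : ∀ X → X ≡ l + r * w → X * suc r + 1 ≡ suc l + r * (w + X)
    next X refl = solve 3 (λ L R W → (L :+ R :* W) :* (con 1 :+ R) :+ con 1
                                     := con 1 :+ L :+ R :* (W :+ (L :+ R :* W))) refl l r w

  length≤ones : ∀ r l → l ≤ ones (suc r) l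
  length≤ones r zero = z≤n
  length≤ones r (suc l) rewrite +-comm (ones (suc r) l * suc r) 1 =
    s≤s (≤-trans (length≤ones r l) (m≤m*n (ones (suc r) l) (suc r)))

  ones-mono : ∀ q {a b} → a ≤ b → ones q a ≤ ones q b
  ones-mono q {a} a≤b with m≤n⇒∃[o]m+o≡n a≤b
  ... | o , refl rewrite +-comm a o | ones-+ q o a = m≤n+m (ones q a) (ones q o * q ^ a)

  ones<pow : ∀ r l → ones (suc (suc r)) l < suc (suc r) ^ l
  ones<pow r l = ≤-trans (≤-reflexive (+-comm 1 (ones (suc (suc r)) l)))
                 (≤-trans (+-monoˡ-≤ 1 (m≤m*n (ones (suc (suc r)) l) (suc r)))
                          (≤-reflexive (ones-geometric (suc r) l)))

  length<pow : ∀ r l → l < suc (suc r) ^ l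
  length<pow r l = ≤-<-trans (length≤ones (suc r) l) (ones<pow r l)

module Decomposition where

  open Repunits
  open import Data.Nat
  open import Data.Nat.Properties
  open import Data.Product using (_,_)
  open import Data.Maybe using (just; nothing; _>>=_)
  open import Data.Sum using (inj₁; inj₂)
  open import Relation.Nullary using (¬_; yes; no)
  open import Relation.Nullary.Negation using (contradiction)
  open import Relation.Binary.PropositionalEquality
  open import Function using (id)
  open import Data.Nat.Solver using (module +-*-Solver)
  open +-*-Solver

  maxLUpTo-spec : ∀ q b u L → L ≤ u → q ^ L ∸ 1 ≤ b
                → (∀ l → L < l → l ≤ u → ¬ (q ^ l ∸ 1 ≤ b)) → maxLUpTo q b u ≡ L
  maxLUpTo-spec q b zero .zero z≤n _ _ = refl
  maxLUpTo-spec q b (suc u) L L≤u adm above with q ^ suc u ∸ 1 ≤? b | m≤n⇒m<n∨m≡n L≤u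
  ... | yes top | inj₁ L<u  = contradiction top (above (suc u) L<u ≤-refl)
  ... | yes _   | inj₂ refl = refl
  ... | no ¬top | inj₂ refl = contradiction adm ¬top
  ... | no _    | inj₁ L<u  =
    maxLUpTo-spec q b u L (≤-pred L<u) adm (λ l L<l l≤u → above l L<l (m≤n⇒m≤1+n l≤u))

  findKUpTo-spec : ∀ q s b u k → k ≤ u → rep q (q ∸ s) k ≤ b → b ≤ ones0 q k
                 → (∀ k' → k < k' → k' ≤ u → ¬ (rep q (q ∸ s) k' ≤ b)) → findKUpTo q s b u ≡ just k
  findKUpTo-spec q s b zero .zero z≤n lo hi _ with rep q (q ∸ s) 0 ≤? b | b ≤? ones0 q 0
  ... | yes _  | yes _  = refl
  ... | yes _  | no ¬hi = contradiction hi ¬hi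
  ... | no ¬lo | _      = contradiction lo ¬lo
  findKUpTo-spec q s b (suc u) k k≤u lo hi above
    with rep q (q ∸ s) (suc u) ≤? b | b ≤? ones0 q (suc u) | m≤n⇒m<n∨m≡n k≤u
  ... | yes top | _      | inj₁ k<u  = contradiction top (above (suc u) k<u ≤-refl)
  ... | yes _   | yes _  | inj₂ refl = refl
  ... | yes _   | no ¬hi | inj₂ refl = contradiction hi ¬hi
  ... | no ¬lo  | _      | inj₂ refl = contradiction lo ¬lo
  ... | no _    | _      | inj₁ k<u  = findKUpTo-spec q s b u k (≤-pred k<u) lo hi (λ k' lt le → above k' lt (m≤n⇒m≤1+n le))

  step-continues : ∀ q b → q ∸ 1 ≤ b → b ∸ (q ^ maxL q b ∸ 1) ≤ ones0 q (maxL q b ∸ 1)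
                 → step q b ≡ just (b ∸ (q ^ maxL q b ∸ 1))
  step-continues q b big small with q ∸ 1 ≤? b
  ... | no ¬big = contradiction big ¬big
  ... | yes _ with b ∸ (q ^ maxL q b ∸ 1) ≤? ones0 q (maxL q b ∸ 1)
  ...   | no ¬small = contradiction small ¬small
  ...   | yes _     = refl

  step-stops : ∀ q b → q ∸ 1 ≤ b → ¬ (b ∸ (q ^ maxL q b ∸ 1) ≤ ones0 q (maxL q b ∸ 1))
             → step q b ≡ nothing
  step-stops q b big ¬small with q ∸ 1 ≤? b
  ... | no ¬big = contradiction big ¬big
  ... | yes _ with b ∸ (q ^ maxL q b ∸ 1) ≤? ones0 q (maxL q b ∸ 1)
  ...   | no _      = refl
  ...   | yes small = contradiction small ¬small

  module Trajectory (r : ℕ) where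

    Q : ℕ
    Q = suc (suc r)

    -- B M J x = [1^(M+1) 0^(J+1)]_Q + x.  Starting from [1^m 0^(J+1)]_Q,
    -- the procedure produces b_(x+1) = B (m-x-1) J x for x ≤ [1^J 0]_Q.
    B : ℕ → ℕ → ℕ → ℕ
    B M J x = ones Q (suc M) * Q ^ suc J + x

    Q^-+ : ∀ M J → Q ^ M * Q ^ suc J ≡ Q ^ (suc M + J)
    Q^-+ M J = trans (sym (^-distribˡ-+-* Q M (suc J))) (cong (Q ^_) (+-suc M J))

    B-split : ∀ M J x → B M J x ≡ Q ^ (suc M + J) + (ones Q M * Q ^ suc J + x)
    B-split M J x rewrite ones-suc Q M | sym (Q^-+ M J) =
      solve 4 (λ a b c d → (a :+ b) :* c :+ d := a :* c :+ (b :* c :+ d)) refl (Q ^ M) (ones Q M) (Q ^ suc J) x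

    B-lower : ∀ M J x → Q ^ (suc M + J) ≤ B M J x
    B-lower M J x rewrite B-split M J x = m≤m+n _ _

    B-upper : ∀ M J x → x ≤ ones Q J * Q → B M J x + 2 ≤ Q ^ suc (suc M + J)
    B-upper M J x x≤ = begin
      ones Q (suc M) * Q ^ suc J + x + 2       ≡⟨ +-assoc (ones Q (suc M) * Q ^ suc J) x 2 ⟩
      ones Q (suc M) * Q ^ suc J + (x + 2)     ≤⟨ +-monoʳ-≤ (ones Q (suc M) * Q ^ suc J) x+2≤ ⟩
      ones Q (suc M) * Q ^ suc J + Q ^ suc J   ≡⟨ +-comm (ones Q (suc M) * Q ^ suc J) (Q ^ suc J) ⟩
      suc (ones Q (suc M)) * Q ^ suc J         ≤⟨ *-monoˡ-≤ (Q ^ suc J) (ones<pow r (suc M)) ⟩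
      Q ^ suc M * Q ^ suc J                    ≡⟨ Q^-+ (suc M) J ⟩
      Q ^ suc (suc M + J)                      ∎
      where
      open ≤-Reasoning
      x+2≤ : x + 2 ≤ Q ^ suc J
      x+2≤ = begin
        x + 2                  ≤⟨ +-monoˡ-≤ 2 x≤ ⟩
        ones Q J * Q + 2       ≡⟨ +-assoc (ones Q J * Q) 1 1 ⟨
        ones Q J * Q + 1 + 1   ≡⟨ +-comm (ones Q (suc J)) 1 ⟩
        suc (ones Q (suc J))   ≤⟨ ones<pow r (suc J) ⟩
        Q ^ suc J              ∎

    maxL-B : ∀ M J x → x ≤ ones Q J * Q → maxL Q (B M J x) ≡ suc M + J
    maxL-B M J x x≤ = maxLUpTo-spec Q (B M J x) (B M J x) (suc M + J)
      (<⇒≤ (<-≤-trans (length<pow r (suc M + J)) (B-lower M J x)))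
      (≤-trans (m∸n≤m _ 1) (B-lower M J x))
      (λ l L<l _ adm → <-irrefl refl (≤-trans (too-big l L<l) adm))
      where
      too-big : ∀ l → suc M + J < l → suc (B M J x) ≤ Q ^ l ∸ 1
      too-big l L<l = m+n≤o⇒m≤o∸n (suc (B M J x))
        (≤-trans (≤-reflexive (trans (+-comm (suc (B M J x)) 1) (+-comm 2 (B M J x))))
                 (≤-trans (B-upper M J x x≤) (^-monoʳ-≤ Q L<l)))

    B-minus : ∀ M J x → B M J x ∸ (Q ^ (suc M + J) ∸ 1) ≡ ones Q M * Q ^ suc J + suc x
    B-minus M J x rewrite B-split M J x with Q ^ (suc M + J) | m^n>0 Q (suc M + J)
    ... | suc y | _ = trans (cong (_∸ y) (sym (+-suc y (ones Q M * Q ^ suc J + x))))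
                        (trans (m+n∸m≡n y (suc (ones Q M * Q ^ suc J + x))) (sym (+-suc _ x)))

    Q-1≤B : ∀ M J x → Q ∸ 1 ≤ B M J x
    Q-1≤B M J x = ≤-trans (m∸n≤m Q 1) (≤-trans (m≤m*n Q (Q ^ (M + J)) {{m^n≢0 Q (M + J)}}) (B-lower M J x))

    stop-test : ∀ M J x → x ≤ ones Q J * Q
              → (B M J x ∸ (Q ^ maxL Q (B M J x) ∸ 1) ≤ ones0 Q (maxL Q (B M J x) ∸ 1))
                ≡ (ones Q M * Q ^ suc J + suc x ≤ ones Q M * Q ^ suc J + ones Q J * Q)
    stop-test M J x x≤ rewrite maxL-B M J x x≤ | B-minus M J x | ones0-+ Q M J = refl

    step-B : ∀ M J x → suc x ≤ ones Q J * Q → step Q (B M J x) ≡ just (ones Q M * Q ^ suc J + suc x)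
    step-B M J x x< = trans
      (step-continues Q (B M J x) (Q-1≤B M J x)
        (subst id (sym (stop-test M J x (<⇒≤ x<))) (+-monoʳ-≤ (ones Q M * Q ^ suc J) x<)))
      (cong just (trans (cong (λ l → B M J x ∸ (Q ^ l ∸ 1)) (maxL-B M J x (<⇒≤ x<))) (B-minus M J x)))

    step-B-stops : ∀ M J x → x ≤ ones Q J * Q → ¬ (suc x ≤ ones Q J * Q) → step Q (B M J x) ≡ nothing
    step-B-stops M J x x≤ ¬x< = step-stops Q (B M J x) (Q-1≤B M J x)
      (λ small → ¬x< (+-cancelˡ-≤ (ones Q M * Q ^ suc J) _ _ (subst id (stop-test M J x x≤) small)))

    trajectory : ∀ x M J → x ≤ ones Q J * Q → bTerm Q (ones-zeros Q (x + suc M) (suc J)) (suc x) ≡ just (B M J x)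
    trajectory zero M J _ = cong just (sym (+-identityʳ _))
    trajectory (suc x) M J x< = begin
      bTerm Q (ones-zeros Q (suc x + suc M) (suc J)) (suc (suc x))   ≡⟨ cong (λ m → bTerm Q (ones-zeros Q m (suc J)) (suc (suc x))) (sym (+-suc x (suc M))) ⟩
      (bTerm Q (ones-zeros Q (x + suc (suc M)) (suc J)) (suc x) >>= step Q) ≡⟨ cong (_>>= step Q) (trajectory x (suc M) J (<⇒≤ x<)) ⟩
      step Q (B (suc M) J x)                                           ≡⟨ step-B (suc M) J x x< ⟩
      just (B M J (suc x))                                             ∎
      where open ≡-Reasoning

    -- For j = 1 we have [1^0 0]_Q = 0, so the procedure stops after b_1.
    trajectory-j=1 : ∀ M → bTerm Q (ones-zeros Q (suc M) 1) 2 ≡ nothing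
    trajectory-j=1 M = subst (λ b → step Q b ≡ nothing) (+-identityʳ (ones Q (suc M) * Q ^ 1))
      (step-B-stops M 0 0 z≤n (λ ()))

    module Level (s : ℕ) (1≤s : 1 ≤ s) (s<Q : s < Q) where

      s̄ : ℕ
      s̄ = Q ∸ s

      s̄+s : s̄ + s ≡ Q
      s̄+s = m∸n+n≡m (<⇒≤ s<Q)

      s̄≤Q-1 : s̄ ≤ suc r
      s̄≤Q-1 = ≤-pred (≤-trans (≤-reflexive (+-comm 1 s̄)) (≤-trans (+-monoʳ-≤ s̄ 1≤s) (≤-reflexive s̄+s)))

      1≤s̄ : 1 ≤ s̄
      1≤s̄ = m<n⇒0<n∸m s<Q

      B-above : ∀ M J x → rep Q s̄ (suc M + J) ≤ B M J x
      B-above M J x = begin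
        s̄ * ones Q (suc M + J)                ≡⟨ cong (s̄ *_) (ones-+ Q (suc M) J) ⟩
        s̄ * (A * X + ones Q J)               ≡⟨ *-distribˡ-+ s̄ (A * X) (ones Q J) ⟩
        s̄ * (A * X) + s̄ * ones Q J           ≤⟨ +-monoʳ-≤ (s̄ * (A * X)) tail≤ ⟩
        s̄ * (A * X) + X                      ≤⟨ +-monoʳ-≤ (s̄ * (A * X)) (≤-trans (m≤n*m X (s * A) {{sA≢0}}) (≤-reflexive (*-assoc s A X))) ⟩
        s̄ * (A * X) + s * (A * X)            ≤⟨ m≤m+n _ x ⟩
        s̄ * (A * X) + s * (A * X) + x        ≡⟨ solve 5 (λ t s a y x → t :* (a :* y) :+ s :* (a :* y) :+ x := a :* ((t :+ s) :* y) :+ x) refl s̄ s A X x ⟩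
        A * ((s̄ + s) * X) + x                ≡⟨ cong (λ z → A * (z * X) + x) s̄+s ⟩
        B M J x                              ∎
        where
        open ≤-Reasoning
        A = ones Q (suc M)
        X = Q ^ J
        tail≤ : s̄ * ones Q J ≤ X
        tail≤ = begin
          s̄ * ones Q J            ≤⟨ *-monoˡ-≤ (ones Q J) s̄≤Q-1 ⟩
          suc r * ones Q J        ≡⟨ *-comm (suc r) (ones Q J) ⟩
          ones Q J * suc r        ≤⟨ m≤m+n _ 1 ⟩
          ones Q J * suc r + 1    ≡⟨ ones-geometric (suc r) J ⟩
          X                       ∎
        sA≢0 : NonZero (s * A)
        sA≢0 = >-nonZero (*-mono-≤ 1≤s (≤-trans (s≤s z≤n) (length≤ones (suc r) (suc M))))

      B-below : ∀ M J x → x ≤ ones Q J * Q → B M J x ≤ ones0 Q (suc M + J)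
      B-below M J x x≤ = subst (B M J x ≤_) (sym (ones0-+ Q (suc M) J)) (+-monoʳ-≤ _ x≤)

      -- No larger level k' > K fits, because B M J x < [1^(K+1)]_Q ≤ [s̄^k']_Q.
      B-below-next : ∀ M J x → x ≤ ones Q J * Q → ∀ k' → suc M + J < k' → ¬ (rep Q s̄ k' ≤ B M J x)
      B-below-next M J x x≤ k' K<k' fits =
        <-irrefl refl (≤-trans B<next (≤-trans (ones-mono Q K<k') (≤-trans (m≤n*m _ s̄ {{>-nonZero 1≤s̄}}) fits)))
        where
        B<next : suc (B M J x) ≤ ones Q (suc (suc M + J))
        B<next = subst (suc (B M J x) ≤_) (trans (sym (ones-+ Q (suc M) (suc J))) (cong (ones Q) (+-suc (suc M) J)))
          (≤-trans (≤-reflexive (sym (+-suc _ x)))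
                   (+-monoʳ-≤ (ones Q (suc M) * Q ^ suc J) (≤-trans (≤-reflexive (+-comm 1 x)) (+-monoˡ-≤ 1 x≤))))

      findK-B : ∀ M J x → x ≤ ones Q J * Q → findK Q s (B M J x) ≡ just (suc M + J)
      findK-B M J x x≤ = findKUpTo-spec Q s (B M J x) (B M J x) (suc M + J)
        (≤-trans (length≤ones (suc r) (suc M + J)) (≤-trans (m≤n*m _ s̄ {{>-nonZero 1≤s̄}}) (B-above M J x)))
        (B-above M J x) (B-below M J x x≤) (λ k' K<k' _ → B-below-next M J x x≤ k' K<k')

      c-B : ∀ M J x → x ≤ ones Q J * Q → B M J x ∸ rep Q s̄ (suc M + J) ≡ s * ones Q (suc M + J) ∸ (ones Q J * Q ∸ x)
      c-B M J x x≤ = begin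
        B M J x ∸ s̄ * oK                       ≡⟨ m+n∸n≡m (B M J x ∸ s̄ * oK) E ⟨
        (B M J x ∸ s̄ * oK) + E ∸ E             ≡⟨ cong (_∸ E) (+-∸-comm E (B-above M J x)) ⟨
        (B M J x + E) ∸ s̄ * oK ∸ E             ≡⟨ cong (λ z → z ∸ s̄ * oK ∸ E) B+E ⟩
        (s̄ * oK + s * oK) ∸ s̄ * oK ∸ E         ≡⟨ cong (_∸ E) (m+n∸m≡n (s̄ * oK) (s * oK)) ⟩
        s * oK ∸ E                              ∎
        where
        open ≡-Reasoning
        oK = ones Q (suc M + J)
        E = ones Q J * Q ∸ x
        B+E : B M J x + E ≡ s̄ * oK + s * oK
        B+E = begin
          ones Q (suc M) * Q ^ suc J + x + E          ≡⟨ +-assoc _ x E ⟩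
          ones Q (suc M) * Q ^ suc J + (x + E)        ≡⟨ cong (ones Q (suc M) * Q ^ suc J +_) (m+[n∸m]≡n x≤) ⟩
          ones Q (suc M) * Q ^ suc J + ones Q J * Q   ≡⟨ ones0-+ Q (suc M) J ⟨
          oK * Q                                      ≡⟨ cong (oK *_) s̄+s ⟨
          oK * (s̄ + s)                                ≡⟨ solve 3 (λ o t s → o :* (t :+ s) := t :* o :+ s :* o) refl oK s̄ s ⟩
          s̄ * oK + s * oK                             ∎

module FiniteFields {c ℓ} (F : CommutativeRing c ℓ) (q : ℕ) (isF : IsFiniteFieldOfOrder F q) where

  open import Data.Nat as ℕ using (zero; suc)
  open import Data.Fin using (Fin)
  import Data.Fin.Properties as Fin
  open import Data.Fin.Permutation using (Permutation; _⟨$⟩ʳ_; permutation)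
  open import Data.Product using (_,_; proj₁; proj₂; Σ)
  open import Data.Sum using (_⊎_; inj₁; inj₂)
  open import Data.Empty using (⊥-elim)
  open import Relation.Nullary using (¬_; yes; no; Dec)
  open import Relation.Nullary.Negation using (contradiction)
  import Relation.Binary.PropositionalEquality as ≡
  import Algebra.Properties.CommutativeMonoid.Sum as BigOp

  open CommutativeRing F
  open IsFiniteFieldOfOrder isF
  open import Algebra.Definitions.RawSemiring (Semiring.rawSemiring semiring) using (_×_) renaming (_^_ to _^ᴿ_)
  open import Algebra.Properties.Semiring.Mult semiring using (×1-homo-*)
  open import Relation.Binary.Reasoning.Setoid setoid

  module Σ+ = BigOp +-commutativeMonoid
  module Π* = BigOp *-commutativeMonoid

  index : Carrier → Fin q
  index y = proj₁ (enum-surj y)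

  enum-index : ∀ y → enum (index y) ≈ y
  enum-index y = proj₂ (enum-surj y)

  _≈?_ : ∀ x y → Dec (x ≈ y)
  x ≈? y with index x Fin.≟ index y
  ... | yes eq = yes (trans (sym (enum-index x)) (trans (reflexive (≡.cong enum eq)) (enum-index y)))
  ... | no ne  = no (λ x≈y → ne (enum-inj _ _ (trans (enum-index x) (trans x≈y (sym (enum-index y))))))

  no-zero-divisors : ∀ x y → x * y ≈ 0# → x ≈ 0# ⊎ y ≈ 0#
  no-zero-divisors x y xy≈0 with x ≈? 0#
  ... | yes x≈0 = inj₁ x≈0
  ... | no x≉0 with inverse x x≉0
  ...   | x⁻¹ , xx⁻¹ = inj₂ (begin
    y              ≈⟨ *-identityˡ y ⟨
    1# * y         ≈⟨ *-cong (trans (*-comm x⁻¹ x) xx⁻¹) refl ⟨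
    x⁻¹ * x * y    ≈⟨ *-assoc x⁻¹ x y ⟩
    x⁻¹ * (x * y)  ≈⟨ *-cong refl xy≈0 ⟩
    x⁻¹ * 0#       ≈⟨ zeroʳ x⁻¹ ⟩
    0#             ∎)

  bijection⇒permutation : (φ ψ : Carrier → Carrier)
    → (∀ {x y} → x ≈ y → φ x ≈ φ y) → (∀ {x y} → x ≈ y → ψ x ≈ ψ y)
    → (∀ y → φ (ψ y) ≈ y) → (∀ y → ψ (φ y) ≈ y)
    → Σ (Permutation q q) λ π → ∀ i → enum (π ⟨$⟩ʳ i) ≈ φ (enum i)
  bijection⇒permutation φ ψ φ-cong ψ-cong φψ ψφ = permutation f g f∘g g∘f , λ i → enum-index (φ (enum i))
    where
    f g : Fin q → Fin q
    f i = index (φ (enum i))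
    g i = index (ψ (enum i))
    f∘g : ∀ i → f (g i) ≡.≡ i
    f∘g i = enum-inj _ _ (trans (enum-index _) (trans (φ-cong (enum-index _)) (φψ (enum i))))
    g∘f : ∀ i → g (f i) ≡.≡ i
    g∘f i = enum-inj _ _ (trans (enum-index _) (trans (ψ-cong (enum-index _)) (ψφ (enum i))))

  -- The characteristic divides q: translating by x permutes the field, so
  -- Σ y = Σ (x + y) = q·x + Σ y.
  q×≈0 : ∀ x → q × x ≈ 0#
  q×≈0 x = cancel (sym (begin
      Σ+.sum enum                             ≈⟨ Σ+.sum-permute enum π ⟩
      Σ+.sum (λ i → enum (π ⟨$⟩ʳ i))          ≈⟨ Σ+.sum-cong-≋ π-spec ⟩
      Σ+.sum (λ i → x + enum i)               ≈⟨ Σ+.∑-distrib-+ {q} (λ _ → x) enum ⟩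
      Σ+.sum {q} (λ _ → x) + Σ+.sum enum      ≈⟨ +-cong (Σ+.sum-replicate q) refl ⟩
      q × x + Σ+.sum enum                     ∎))
    where
    translation = bijection⇒permutation (x +_) (- x +_) (+-cong refl) (+-cong refl)
      (λ y → trans (sym (+-assoc x (- x) y)) (trans (+-cong (-‿inverseʳ x) refl) (+-identityˡ y)))
      (λ y → trans (sym (+-assoc (- x) x y)) (trans (+-cong (-‿inverseˡ x) refl) (+-identityˡ y)))
    π = proj₁ translation
    π-spec = proj₂ translation
    cancel : ∀ {a b} → a + b ≈ b → a ≈ 0#
    cancel {a} {b} a+b≈b = begin
      a                 ≈⟨ +-identityʳ a ⟨
      a + 0#            ≈⟨ +-cong refl (-‿inverseʳ b) ⟨
      a + (b + - b)     ≈⟨ +-assoc a b (- b) ⟨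
      (a + b) + - b     ≈⟨ +-cong a+b≈b refl ⟩
      b + - b           ≈⟨ -‿inverseʳ b ⟩
      0#                ∎

  product≉0 : ∀ n (v : Fin n → Carrier) → (∀ i → ¬ v i ≈ 0#) → ¬ Π*.sum v ≈ 0#
  product≉0 zero    v v≉0 1≈0 = 0≉1 (sym 1≈0)
  product≉0 (suc n) v v≉0 Πv≈0 with no-zero-divisors (v Fin.zero) (Π*.sum (λ i → v (Fin.suc i))) Πv≈0
  ... | inj₁ v₀≈0  = v≉0 Fin.zero v₀≈0
  ... | inj₂ rest≈0 = product≉0 n (λ i → v (Fin.suc i)) (λ i → v≉0 (Fin.suc i)) rest≈0

  unzero : Carrier → Carrier
  unzero y with y ≈? 0#
  ... | yes _ = 1#
  ... | no  _ = y

  unzero≉0 : ∀ y → ¬ unzero y ≈ 0#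
  unzero≉0 y with y ≈? 0#
  ... | yes _   = λ 1≈0 → 0≉1 (sym 1≈0)
  ... | no y≉0  = y≉0

  unzero-cong : ∀ {y z} → y ≈ z → unzero y ≈ unzero z
  unzero-cong {y} {z} y≈z with y ≈? 0# | z ≈? 0#
  ... | yes _   | yes _   = refl
  ... | yes y≈0 | no z≉0  = contradiction (trans (sym y≈z) y≈0) z≉0
  ... | no y≉0  | yes z≈0 = contradiction (trans y≈z z≈0) y≉0
  ... | no _    | no _    = y≈z

  -- With W = Π unzero y over the
  -- field, multiplication by x permutes the field, and x·unzero y equals
  -- unzero (x·y) except at y = 0, where it is off by the factor x; hence
  -- x^q·W = x·W, and W is invertible.
  module Fermat (x : Carrier) (x≉0 : ¬ x ≈ 0#) where

    zero-mark : Carrier → Carrier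
    zero-mark y with y ≈? 0#
    ... | yes _ = x
    ... | no  _ = 1#

    scale-unzero : ∀ y → x * unzero y ≈ unzero (x * y) * zero-mark y
    scale-unzero y with y ≈? 0# | (x * y) ≈? 0#
    ... | yes _   | yes _    = *-comm x 1#
    ... | yes y≈0 | no xy≉0  = contradiction (trans (*-cong refl y≈0) (zeroʳ x)) xy≉0
    ... | no _    | no _     = sym (*-identityʳ (x * y))
    ... | no y≉0  | yes xy≈0 with no-zero-divisors x y xy≈0
    ...   | inj₁ x≈0 = contradiction x≈0 x≉0
    ...   | inj₂ y≈0 = contradiction y≈0 y≉0

    marks-of-nonzero : ∀ n (v : Fin n → Carrier) → (∀ i → ¬ v i ≈ 0#) → Π*.sum (λ i → zero-mark (v i)) ≈ 1#
    marks-of-nonzero zero    v v≉0 = refl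
    marks-of-nonzero (suc n) v v≉0 with v Fin.zero ≈? 0#
    ... | yes v₀≈0 = contradiction v₀≈0 (v≉0 Fin.zero)
    ... | no _     = trans (*-identityˡ _) (marks-of-nonzero n (λ i → v (Fin.suc i)) (λ i → v≉0 (Fin.suc i)))

    marks-of-one-zero : ∀ n (v : Fin n → Carrier) (i₀ : Fin n) → v i₀ ≈ 0#
                      → (∀ i → v i ≈ 0# → i ≡.≡ i₀) → Π*.sum (λ i → zero-mark (v i)) ≈ x
    marks-of-one-zero (suc n) v Fin.zero v₀≈0 unique with v Fin.zero ≈? 0#
    ... | no v₀≉0 = contradiction v₀≈0 v₀≉0
    ... | yes _   = trans (*-cong refl (marks-of-nonzero n (λ i → v (Fin.suc i)) (λ i vᵢ≈0 → suc≢zero (unique (Fin.suc i) vᵢ≈0))))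
                          (*-identityʳ x)
      where
      suc≢zero : ∀ {i : Fin n} → ¬ Fin.suc i ≡.≡ Fin.zero
      suc≢zero ()
    marks-of-one-zero (suc n) v (Fin.suc i₀) vᵢ₀≈0 unique with v Fin.zero ≈? 0#
    ... | yes v₀≈0 = ⊥-elim (zero≢suc (unique Fin.zero v₀≈0))
      where
      zero≢suc : ¬ Fin.zero ≡.≡ Fin.suc i₀
      zero≢suc ()
    ... | no _     = trans (*-identityˡ _)
      (marks-of-one-zero n (λ i → v (Fin.suc i)) i₀ vᵢ₀≈0 (λ i vᵢ≈0 → Fin.suc-injective (unique (Fin.suc i) vᵢ≈0)))

    W : Carrier
    W = Π*.sum (λ i → unzero (enum i))

    scaled-W : Π*.sum (λ i → unzero (x * enum i)) ≈ W
    scaled-W = sym (trans (Π*.sum-permute (λ i → unzero (enum i)) π) (Π*.sum-cong-≋ (λ i → unzero-cong (π-spec i))))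
      where
      x⁻¹ = proj₁ (inverse x x≉0)
      xx⁻¹ = proj₂ (inverse x x≉0)
      scaling = bijection⇒permutation (x *_) (x⁻¹ *_) (*-cong refl) (*-cong refl)
        (λ y → trans (sym (*-assoc x x⁻¹ y)) (trans (*-cong xx⁻¹ refl) (*-identityˡ y)))
        (λ y → trans (sym (*-assoc x⁻¹ x y)) (trans (*-cong (trans (*-comm x⁻¹ x) xx⁻¹) refl) (*-identityˡ y)))
      π = proj₁ scaling
      π-spec = proj₂ scaling

    x^q*W≈x*W : x ^ᴿ q * W ≈ x * W
    x^q*W≈x*W = begin
      x ^ᴿ q * W                                               ≈⟨ *-cong (Π*.sum-replicate q) refl ⟨
      Π*.sum {q} (λ _ → x) * W                                 ≈⟨ Π*.∑-distrib-+ {q} (λ _ → x) (λ i → unzero (enum i)) ⟨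
      Π*.sum (λ i → x * unzero (enum i))                       ≈⟨ Π*.sum-cong-≋ (λ i → scale-unzero (enum i)) ⟩
      Π*.sum (λ i → unzero (x * enum i) * zero-mark (enum i))  ≈⟨ Π*.∑-distrib-+ (λ i → unzero (x * enum i)) (λ i → zero-mark (enum i)) ⟩
      Π*.sum (λ i → unzero (x * enum i)) * Π*.sum (λ i → zero-mark (enum i))
        ≈⟨ *-cong scaled-W (marks-of-one-zero q enum (index 0#) (enum-index 0#) (λ i eᵢ≈0 → enum-inj i (index 0#) (trans eᵢ≈0 (sym (enum-index 0#))))) ⟩
      W * x                                                    ≈⟨ *-comm W x ⟩
      x * W                                                    ∎

    fermat≉0 : x ^ᴿ q ≈ x
    fermat≉0 with inverse W (product≉0 q (λ i → unzero (enum i)) (λ i → unzero≉0 (enum i)))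
    ... | W⁻¹ , WW⁻¹ = begin
      x ^ᴿ q                 ≈⟨ *-identityʳ _ ⟨
      x ^ᴿ q * 1#            ≈⟨ *-cong refl WW⁻¹ ⟨
      x ^ᴿ q * (W * W⁻¹)     ≈⟨ *-assoc _ W W⁻¹ ⟨
      (x ^ᴿ q * W) * W⁻¹     ≈⟨ *-cong x^q*W≈x*W refl ⟩
      (x * W) * W⁻¹          ≈⟨ *-assoc x W W⁻¹ ⟩
      x * (W * W⁻¹)          ≈⟨ *-cong refl WW⁻¹ ⟩
      x * 1#                 ≈⟨ *-identityʳ x ⟩
      x                      ∎

  fermat : ∀ x → x ^ᴿ q ≈ x
  fermat x with x ≈? 0#
  ... | no x≉0 = Fermat.fermat≉0 x x≉0
  ... | yes x≈0 = trans (power-of-zero q {{Fin.nonZeroIndex (index 0#)}}) (sym x≈0)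
    where
    power-of-zero : ∀ n → .{{ℕ.NonZero n}} → x ^ᴿ n ≈ 0#
    power-of-zero (suc n) = trans (*-cong x≈0 refl) (zeroˡ _)

  -- If q = p^e with e ≥ 1 then p·1 = 0, because (p·1)^e = q·1 = 0 and
  -- F has no zero divisors.
  p×1≈0 : ∀ p e → 1 ℕ.≤ e → q ≡.≡ p ℕ.^ e → p × 1# ≈ 0#
  p×1≈0 p (suc e) _ q≡p^e =
    root-of-zero (p × 1#) e (trans (×1-^ p (suc e)) (trans (reflexive (≡.cong (_× 1#) (≡.sym q≡p^e))) (q×≈0 1#)))
    where
    ×1-^ : ∀ m n → (m × 1#) ^ᴿ n ≈ (m ℕ.^ n) × 1#
    ×1-^ m zero    = sym (+-identityʳ 1#)
    ×1-^ m (suc n) = trans (*-cong refl (×1-^ m n)) (sym (×1-homo-* m (m ℕ.^ n)))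
    root-of-zero : ∀ y n → y ^ᴿ suc n ≈ 0# → y ≈ 0#
    root-of-zero y zero    yⁿ≈0 = trans (sym (*-identityʳ y)) yⁿ≈0
    root-of-zero y (suc n) yⁿ≈0 with no-zero-divisors y (y ^ᴿ suc n) yⁿ≈0
    ... | inj₁ y≈0 = y≈0
    ... | inj₂ rest≈0 = root-of-zero y n rest≈0

module BinomialsModPrime where

  open import Data.Nat
  open import Data.Nat.Properties
  open import Data.Nat.Combinatorics
  open import Data.Nat.Divisibility
  open import Data.Nat.Primality
  open import Data.Sum using (inj₁; inj₂)
  open import Relation.Binary.PropositionalEquality
  open import Data.Nat.Solver using (module +-*-Solver)
  open +-*-Solver

  absorption : ∀ n i → suc i * (suc n C suc i) ≡ suc n * (n C i)
  absorption zero zero = refl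
  absorption zero (suc i) = begin
    suc (suc i) * (1 C suc (suc i))   ≡⟨ cong (suc (suc i) *_) (k>n⇒nCk≡0 {1} {suc (suc i)} (s≤s (s≤s z≤n))) ⟩
    suc (suc i) * 0                   ≡⟨ *-zeroʳ (suc (suc i)) ⟩
    0                                 ≡⟨ cong (1 *_) (k>n⇒nCk≡0 {0} {suc i} (s≤s z≤n)) ⟨
    1 * (0 C suc i)                   ∎
    where open ≡-Reasoning
  absorption (suc n) zero = trans (*-identityˡ _) (trans (nC1≡n (suc (suc n))) (sym (*-identityʳ (suc (suc n)))))
  absorption (suc n) (suc i) = begin
    suc (suc i) * (suc (suc n) C suc (suc i))   ≡⟨ cong (suc (suc i) *_) (nCk+nC[k+1]≡[n+1]C[k+1] (suc n) (suc i)) ⟨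
    suc (suc i) * (A + B)                       ≡⟨ solve 3 (λ i A B → (con 2 :+ i) :* (A :+ B) := (con 1 :+ i) :* A :+ A :+ (con 2 :+ i) :* B) refl i A B ⟩
    suc i * A + A + suc (suc i) * B             ≡⟨ cong₂ (λ u v → u + A + v) (absorption n i) (absorption n (suc i)) ⟩
    suc n * a + A + suc n * b                   ≡⟨ solve 4 (λ n a b A → (con 1 :+ n) :* a :+ A :+ (con 1 :+ n) :* b := (con 1 :+ n) :* (a :+ b) :+ A) refl n a b A ⟩
    suc n * (a + b) + A                         ≡⟨ cong (λ u → suc n * u + A) (nCk+nC[k+1]≡[n+1]C[k+1] n i) ⟩
    suc n * A + A                               ≡⟨ solve 2 (λ n A → (con 1 :+ n) :* A :+ A := (con 2 :+ n) :* A) refl n A ⟩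
    suc (suc n) * A                             ∎
    where
    open ≡-Reasoning
    A = suc n C suc i
    B = suc n C suc (suc i)
    a = n C i
    b = n C suc i

  -- A factor 0 < i < p^t cannot absorb all of p^t:  p^t ∣ i·X ⇒ p ∣ X.
  prime-power-∣-cofactor : ∀ p t i X → Prime p → p ^ t ∣ i * X → 0 < i → i < p ^ t → p ∣ X
  prime-power-∣-cofactor p zero i X pp _ (s≤s z≤n) (s≤s ())
  prime-power-∣-cofactor p (suc t) i X pp p^t∣iX 0<i i<p^t with euclidsLemma i X pp (∣-trans (∣m⇒∣m*n (p ^ t) ∣-refl) p^t∣iX)
  ... | inj₂ p∣X = p∣X
  ... | inj₁ (divides i′ refl) = prime-power-∣-cofactor p t i′ X pp p^t∣i′X (pos i′ 0<i) i′<p^t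
    where
    instance
      p≢0 : NonZero p
      p≢0 = prime⇒nonZero pp
    p^t∣i′X : p ^ t ∣ i′ * X
    p^t∣i′X = *-cancelˡ-∣ p (subst (p * p ^ t ∣_) (solve 3 (λ i p x → i :* p :* x := p :* (i :* x)) refl i′ p X) p^t∣iX)
    pos : ∀ j → 0 < j * p → 0 < j
    pos (suc _) _ = s≤s z≤n
    i′<p^t : i′ < p ^ t
    i′<p^t = *-cancelʳ-< p i′ (p ^ t) (subst (i′ * p <_) (*-comm p (p ^ t)) i<p^t)

  p∣binomial : ∀ p t L i → Prime p → p ^ t ∣ L → 0 < i → i < p ^ t → p ∣ L C i
  p∣binomial p t zero    (suc i) pp _ _ _ = subst (p ∣_) (sym (k>n⇒nCk≡0 {0} {suc i} (s≤s z≤n))) (p ∣0)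
  p∣binomial p t (suc L) (suc i) pp p^t∣L 0<i i<p^t = prime-power-∣-cofactor p t (suc i) (suc L C suc i) pp
    (subst (p ^ t ∣_) (sym (absorption L i)) (∣m⇒∣m*n (L C i) p^t∣L)) 0<i i<p^t

module CharacteristicP {c ℓ} (S : Semiring c ℓ) (p : ℕ) where

  open BinomialsModPrime using (p∣binomial)
  open import Data.Nat as ℕ using (zero; suc; _<_; s≤s; z≤n)
  import Data.Nat.Properties as ℕ
  open import Data.Nat.Combinatorics using (_C_; nCk+nC[k+1]≡[n+1]C[k+1])
  open import Data.Nat.Combinatorics.Specification using (k>n⇒nCk≡0)
  open import Data.Nat.Divisibility using (_∣_; divides)
  open import Data.Nat.Primality using (Prime)
  import Relation.Binary.PropositionalEquality as ≡

  open Semiring S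
  open import Algebra.Definitions.RawSemiring rawSemiring using (_×_)
  open import Algebra.Properties.Semiring.Mult S using (×1-homo-*)
  open import Algebra.Properties.Monoid.Mult +-monoid using (×-homo-+)
  open import Relation.Binary.Reasoning.Setoid setoid

  module _ (p×1≈0 : p × 1# ≈ 0#) where

    multiple-of-p×1≈0 : ∀ n → p ∣ n → n × 1# ≈ 0#
    multiple-of-p×1≈0 n (divides k ≡.refl) = trans (×1-homo-* k p) (trans (*-cong refl p×1≈0) (zeroʳ _))

    binomial-shift : ∀ t L → Prime p → p ℕ.^ t ∣ L → ∀ A e → e < p ℕ.^ t → ((A ℕ.+ L) C e) × 1# ≈ (A C e) × 1#
    binomial-shift t L pp p^t∣L zero    zero    _ = refl
    binomial-shift t L pp p^t∣L (suc A) zero    _ = refl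
    binomial-shift t L pp p^t∣L zero    (suc e) e<p^t = trans
      (multiple-of-p×1≈0 (L C suc e) (p∣binomial p t L (suc e) pp p^t∣L (s≤s z≤n) e<p^t))
      (reflexive (≡.cong (_× 1#) (≡.sym (k>n⇒nCk≡0 {0} {suc e} (s≤s z≤n)))))
    binomial-shift t L pp p^t∣L (suc A) (suc e) e<p^t = begin
      (suc (A ℕ.+ L) C suc e) × 1#                         ≈⟨ reflexive (≡.cong (_× 1#) (nCk+nC[k+1]≡[n+1]C[k+1] (A ℕ.+ L) e)) ⟨
      ((A ℕ.+ L) C e ℕ.+ (A ℕ.+ L) C suc e) × 1#           ≈⟨ ×-homo-+ 1# ((A ℕ.+ L) C e) ((A ℕ.+ L) C suc e) ⟩
      ((A ℕ.+ L) C e) × 1# + ((A ℕ.+ L) C suc e) × 1#      ≈⟨ +-cong (binomial-shift t L pp p^t∣L A e (ℕ.<⇒≤ e<p^t)) (binomial-shift t L pp p^t∣L A (suc e) e<p^t) ⟩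
      (A C e) × 1# + (A C suc e) × 1#                      ≈⟨ ×-homo-+ 1# (A C e) (A C suc e) ⟨
      (A C e ℕ.+ A C suc e) × 1#                           ≈⟨ reflexive (≡.cong (_× 1#) (nCk+nC[k+1]≡[n+1]C[k+1] A e)) ⟩
      (suc A C suc e) × 1#                                 ∎

module PeriodicPowers {c ℓ} (S : Semiring c ℓ) where

  open import Data.Nat as ℕ using (zero; suc; _≤_)
  import Data.Nat.Properties as ℕ
  open import Relation.Binary.PropositionalEquality as ≡ using (_≡_)
  open Semiring S
  open import Algebra.Properties.Semiring.Exp S using (_^_; ^-homo-*)
  open import Relation.Binary.Reasoning.Setoid setoid
  open import Data.Nat.Solver using (module +-*-Solver)
  open +-*-Solver

  module _ (x : Carrier) (r : ℕ) (x^r+1≈x : x ^ suc r ≈ x) where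

    one-period : ∀ u → x ^ (suc u ℕ.+ r) ≈ x ^ suc u
    one-period u = begin
      x ^ (suc u ℕ.+ r)   ≡⟨ ≡.cong (x ^_) (ℕ.+-suc u r) ⟨
      x ^ (u ℕ.+ suc r)   ≈⟨ ^-homo-* x u (suc r) ⟩
      x ^ u * x ^ suc r   ≈⟨ *-cong refl x^r+1≈x ⟩
      x ^ u * x           ≈⟨ *-cong refl (*-identityʳ x) ⟨
      x ^ u * x ^ 1       ≈⟨ ^-homo-* x u 1 ⟨
      x ^ (u ℕ.+ 1)       ≡⟨ ≡.cong (x ^_) (ℕ.+-comm u 1) ⟩
      x ^ suc u           ∎

    power-period : ∀ c Z → 1 ≤ c → x ^ (c ℕ.+ r ℕ.* Z) ≈ x ^ c
    power-period c zero _ = reflexive (≡.cong (x ^_) (≡.trans (≡.cong (c ℕ.+_) (ℕ.*-zeroʳ r)) (ℕ.+-identityʳ c)))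
    power-period (suc c) (suc Z) 1≤c = begin
      x ^ (suc c ℕ.+ r ℕ.* suc Z)   ≡⟨ ≡.cong (x ^_) (solve 3 (λ c r z → con 1 :+ c :+ r :* (con 1 :+ z) := con 1 :+ (c :+ r :* z) :+ r) ≡.refl c r Z) ⟩
      x ^ (suc (c ℕ.+ r ℕ.* Z) ℕ.+ r) ≈⟨ one-period (c ℕ.+ r ℕ.* Z) ⟩
      x ^ (suc c ℕ.+ r ℕ.* Z)       ≈⟨ power-period (suc c) Z 1≤c ⟩
      x ^ suc c                     ∎

module EvaluatingD where

  open import Data.Maybe using (just; nothing)
  open import Relation.Binary.PropositionalEquality using (_≡_; refl)

  d-defined : ∀ {c ℓ} (F : CommutativeRing c ℓ) q s a j m n b k
            → bjmn q j m n ≡ just b → findK q s b ≡ just k → d F q s a j m n ≡ dValue F q s a n b k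
  d-defined F q s a j m n b k b≡ k≡ with bjmn q j m n | b≡
  ... | .(just b) | refl with findK q s b | k≡
  ...   | .(just k) | refl = refl

  d-undefined : ∀ {c ℓ} (F : CommutativeRing c ℓ) q s a j m n
              → bjmn q j m n ≡ nothing → d F q s a j m n ≡ CommutativeRing.0# F
  d-undefined F q s a j m n b≡ with bjmn q j m n | b≡
  ... | .nothing | refl = refl

import Data.Nat.Base as ℕ
import Data.Nat.Properties as ℕₚ
open import Data.Nat.Base using (zero; suc)
open import Data.Nat.Primality using (Prime)
open import Relation.Binary.PropositionalEquality as ≡ using (_≡_)

module Periodicity {c ℓ} (F : CommutativeRing c ℓ) (r : ℕ) (isF : IsFiniteFieldOfOrder F (suc (suc r)))
  (p e : ℕ) (pp : Prime p) (1≤e : 1 ℕ.≤ e) (q≡p^e : suc (suc r) ≡ p ℕ.^ e)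
  (a : CommutativeRing.Carrier F) (s : ℕ) (1<s : 1 ℕ.< s) (s<q : s ℕ.< suc (suc r))
  (J i : ℕ) (i≤ : i ℕ.≤ ones (suc (suc r)) J ℕ.* suc (suc r)) where

  open Repunits
  open Decomposition
  open Trajectory r
  open Level s (ℕₚ.<⇒≤ 1<s) s<q
  open EvaluatingD

  open FiniteFields F Q isF
  open CommutativeRing F
  open CharacteristicP semiring p
  open PeriodicPowers semiring
  open import Data.Nat.Base using (_∸_)
  open import Data.Nat.Combinatorics using (_C_; nCk≡nC[n∸k])
  open import Data.Nat.Divisibility using (_∣_; ∣m⇒∣m*n; ∣n⇒∣m*n; ∣-refl)
  open import Data.Product using (∃; _,_)
  open import Algebra.Definitions.RawSemiring (Semiring.rawSemiring semiring) using (_×_) renaming (_^_ to _^ᴿ_)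
  open import Algebra.Properties.Semiring.Exp semiring using (^-congʳ)
  open import Relation.Binary.Reasoning.Setoid setoid
  open import Data.Nat.Solver using (module +-*-Solver)
  open +-*-Solver using (solve; _:*_; _:+_; con; _:=_)

  -- E = [1^J 0]_q - i and N k = [s^k]_q, so that c_(j,m,n) = N k - E.
  E : ℕ
  E = ones Q J ℕ.* Q ∸ i

  N : ℕ → ℕ
  N k = s ℕ.* ones Q k

  value : ℕ → Carrier
  value k = ((- 1#) ^ᴿ (k ℕ.* (s ∸ 1)) * ((N k C E) × 1#)) * ((- a) ^ᴿ (N k ∸ E) * (- 1#) ^ᴿ i)

  -- For levels k ≥ J + 1 the binomial coefficient and power below are well defined: E < N k.
  E<N : ∀ k → suc J ℕ.≤ k → E ℕ.< N k
  E<N k J<k = ℕₚ.≤-trans (ℕ.s≤s (ℕₚ.m∸n≤m _ i))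
    (ℕₚ.≤-trans (ℕₚ.≤-reflexive (ℕₚ.+-comm 1 _))
      (ℕₚ.≤-trans (ones-mono Q J<k) (ℕₚ.m≤n*m (ones Q k) s {{ℕ.>-nonZero (ℕₚ.<⇒≤ 1<s)}})))

  closed-form : ∀ M → d F Q s a (suc J) (i ℕ.+ suc M) (suc i) ≡ value (suc M ℕ.+ J)
  closed-form M = ≡.trans (d-defined F Q s a (suc J) (i ℕ.+ suc M) (suc i) (B M J i) K (trajectory i M J i≤) (findK-B M J i i≤))
    (≡.cong₂ (λ cc bc → ((- 1#) ^ᴿ (K ℕ.* (s ∸ 1)) * (bc × 1#)) * ((- a) ^ᴿ cc * (- 1#) ^ᴿ i)) c≡ binomial≡)
    where
    K = suc M ℕ.+ J
    c≡ : B M J i ∸ rep Q (Q ∸ s) K ≡ N K ∸ E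
    c≡ = c-B M J i i≤
    binomial≡ : N K C (B M J i ∸ rep Q (Q ∸ s) K) ≡ N K C E
    binomial≡ = ≡.trans (≡.cong (N K C_) c≡) (≡.sym (nCk≡nC[n∸k] (ℕₚ.<⇒≤ (E<N K (ℕ.s≤s (ℕₚ.m≤n+m J M))))))

  T : ℕ
  T = suc r

  L : ℕ → ℕ
  L k = s ℕ.* (ones Q T ℕ.* Q ℕ.^ k)

  -- N (k + T) = N k + L k, since [1^(k+T)]_q = [1^T 0^k]_q + [1^k]_q.
  N-shift : ∀ k → N (k ℕ.+ T) ≡ N k ℕ.+ L k
  N-shift k = ≡.trans (≡.cong (λ l → s ℕ.* ones Q l) (ℕₚ.+-comm k T))
    (≡.trans (≡.cong (s ℕ.*_) (ones-+ Q T k)) (≡.trans (ℕₚ.*-distribˡ-+ s _ _) (ℕₚ.+-comm (L k) (N k))))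

  Q^[J+1] : Q ℕ.^ suc J ≡ p ℕ.^ (e ℕ.* suc J)
  Q^[J+1] = ≡.trans (≡.cong (ℕ._^ suc J) q≡p^e) (ℕₚ.^-*-assoc p e (suc J))

  p^[e[J+1]]∣L : ∀ k → suc J ℕ.≤ k → p ℕ.^ (e ℕ.* suc J) ∣ L k
  p^[e[J+1]]∣L k J<k with ℕₚ.m≤n⇒∃[o]m+o≡n J<k
  ... | o , ≡.refl = ∣n⇒∣m*n s (∣n⇒∣m*n (ones Q T)
    (≡.subst (_∣ Q ℕ.^ (suc J ℕ.+ o)) Q^[J+1]
      (≡.subst (Q ℕ.^ suc J ∣_) (≡.sym (ℕₚ.^-distribˡ-+-* Q (suc J) o)) (∣m⇒∣m*n (Q ℕ.^ o) ∣-refl))))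

  E<p^[e[J+1]] : E ℕ.< p ℕ.^ (e ℕ.* suc J)
  E<p^[e[J+1]] = ≡.subst (E ℕ.<_) Q^[J+1]
    (ℕₚ.≤-<-trans (ℕₚ.m∸n≤m _ i) (ℕₚ.<-trans (ℕₚ.≤-reflexive (ℕₚ.+-comm 1 (ones Q J ℕ.* Q))) (ones<pow r (suc J))))

  -- L k is a multiple of q - 1, since [1^T]_q ≡ T ≡ 0 (mod q - 1).
  L≡T*Z : ∀ k → ∃ λ Z → L k ≡ T ℕ.* Z
  L≡T*Z k with ones-≡-length (suc r) T
  ... | w , ones≡ = s ℕ.* ((1 ℕ.+ w) ℕ.* Q ℕ.^ k) , ≡.trans (≡.cong (λ z → s ℕ.* (z ℕ.* Q ℕ.^ k)) ones≡)
      (solve 4 (λ s r w x → s :* (((con 1 :+ r) :+ (con 1 :+ r) :* w) :* x) := (con 1 :+ r) :* (s :* ((con 1 :+ w) :* x))) ≡.refl s r w (Q ℕ.^ k))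

  sign-period : ∀ k → 1 ℕ.≤ k → (- 1#) ^ᴿ ((k ℕ.+ T) ℕ.* (s ∸ 1)) ≈ (- 1#) ^ᴿ (k ℕ.* (s ∸ 1))
  sign-period k 1≤k = trans (^-congʳ (- 1#) (ℕₚ.*-distribʳ-+ (s ∸ 1) k T))
    (power-period (- 1#) T (fermat (- 1#)) (k ℕ.* (s ∸ 1)) (s ∸ 1) (ℕₚ.*-mono-≤ 1≤k (ℕₚ.m<n⇒0<n∸m 1<s)))

  binomial-period : ∀ k → suc J ℕ.≤ k → (N (k ℕ.+ T) C E) × 1# ≈ (N k C E) × 1#
  binomial-period k J<k = trans (reflexive (≡.cong (λ n → (n C E) × 1#) (N-shift k)))
    (binomial-shift (p×1≈0 p e 1≤e q≡p^e) (e ℕ.* suc J) (L k) pp (p^[e[J+1]]∣L k J<k) (N k) E E<p^[e[J+1]])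

  power-of-a-period : ∀ k → suc J ℕ.≤ k → (- a) ^ᴿ (N (k ℕ.+ T) ∸ E) ≈ (- a) ^ᴿ (N k ∸ E)
  power-of-a-period k J<k with L≡T*Z k
  ... | Z , L≡ = trans (^-congʳ (- a) exponent≡) (power-period (- a) T (fermat (- a)) (N k ∸ E) Z (ℕₚ.m<n⇒0<n∸m (E<N k J<k)))
    where
    exponent≡ : N (k ℕ.+ T) ∸ E ≡ (N k ∸ E) ℕ.+ T ℕ.* Z
    exponent≡ = ≡.trans (≡.cong (_∸ E) (N-shift k))
      (≡.trans (ℕₚ.+-∸-comm (L k) (ℕₚ.<⇒≤ (E<N k J<k))) (≡.cong ((N k ∸ E) ℕ.+_) L≡))

  value-period : ∀ k → suc J ℕ.≤ k → value (k ℕ.+ T) ≈ value k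
  value-period k J<k = *-cong (*-cong (sign-period k (ℕₚ.≤-trans (ℕ.s≤s ℕ.z≤n) J<k)) (binomial-period k J<k))
                              (*-cong (power-of-a-period k J<k) refl)

  d-period : ∀ M → d F Q s a (suc J) ((i ℕ.+ suc M) ℕ.+ T) (suc i) ≈ d F Q s a (suc J) (i ℕ.+ suc M) (suc i)
  d-period M = begin
    d F Q s a (suc J) ((i ℕ.+ suc M) ℕ.+ T) (suc i)   ≡⟨ ≡.cong (λ m → d F Q s a (suc J) m (suc i)) (ℕₚ.+-assoc i (suc M) T) ⟩
    d F Q s a (suc J) (i ℕ.+ suc (M ℕ.+ T)) (suc i)   ≡⟨ closed-form (M ℕ.+ T) ⟩
    value (suc (M ℕ.+ T) ℕ.+ J)                       ≡⟨ ≡.cong value (≡.cong suc swap) ⟩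
    value ((suc M ℕ.+ J) ℕ.+ T)                       ≈⟨ value-period (suc M ℕ.+ J) (ℕ.s≤s (ℕₚ.m≤n+m J M)) ⟩
    value (suc M ℕ.+ J)                               ≡⟨ closed-form M ⟨
    d F Q s a (suc J) (i ℕ.+ suc M) (suc i)           ∎
    where
    swap : M ℕ.+ T ℕ.+ J ≡ M ℕ.+ J ℕ.+ T
    swap = ≡.trans (ℕₚ.+-assoc M T J) (≡.trans (≡.cong (M ℕ.+_) (ℕₚ.+-comm T J)) (≡.sym (ℕₚ.+-assoc M J T)))

open import Algebra.Bundles using (CommutativeRing)
open import Data.Nat using (ℕ; _+_; _∸_; _^_; _≤_; _<_)
open import Data.Nat.Primality using (Prime)
open import Data.Product using (∃; _×_)
open import Relation.Binary.PropositionalEquality using (_≡_)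

open import Data.Nat using (zero; suc; s≤s; z≤n; _*_)
open import Data.Nat.Properties using (≤-trans; ≤-reflexive; ≤-pred; +-comm; +-suc; *-comm; *-monoˡ-≤; m≤m+n; m≤n⇒∃[o]m+o≡n)
open import Data.Product using (_,_)
open import Data.Sum using (_⊎_; inj₁; inj₂)
open ≡ using (refl)
open Repunits using (ones-suc)

-- The hypothesis n ≤ q^(j-1) + 1 means i ≤ [1^J 0]_q for n = i + 1 and
-- j = J + 1, except for the single case j = 1, n = 2.
n-range : ∀ q J i → suc i ≤ q ^ J + 1 → i ≤ ones q J * q ⊎ (J ≡ 0 × i ≡ 1)
n-range q zero    zero          _ = inj₁ z≤n
n-range q zero    (suc zero)    _ = inj₂ (refl , refl)
n-range q zero    (suc (suc i)) (s≤s (s≤s ()))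
n-range q (suc J) i n≤ = inj₁ (≤-trans (≤-pred (≤-trans n≤ (≤-reflexive (+-comm (q ^ suc J) 1))))
  (≤-trans (≤-reflexive (*-comm q (q ^ J))) (*-monoˡ-≤ q (≤-trans (m≤m+n (q ^ J) (ones q J)) (≤-reflexive (≡.sym (ones-suc q J)))))))

lemma6 : ∀ {c ℓ} (p e q : ℕ) → Prime p → 1 ≤ e → q ≡ p ^ e
    → (F : CommutativeRing c ℓ) → IsFiniteFieldOfOrder F q
    → (a : CommutativeRing.Carrier F) (s : ℕ) → 1 < s → s < q
    → (j n : ℕ) → 1 ≤ j → 1 ≤ n → n ≤ q ^ (j ∸ 1) + 1
    → ∃ λ T → 1 ≤ T × (∀ m → n ≤ m →
    CommutativeRing._≈_ F (d F q s a j (m + T) n) (d F q s a j m n))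
-- q ≥ 2 since 1 < s < q; for q = r + 2 the period is q - 1 = r + 1.
lemma6 p e zero          _ _ _ F _ a s 1<s ()
lemma6 p e (suc zero)    _ _ _ F _ a s (s≤s _) (s≤s ())
lemma6 p e (suc (suc r)) pp 1≤e q≡p^e F isF a s 1<s s<q (suc J) (suc i) _ _ n≤ = suc r , s≤s z≤n , periodic
  where
  open CommutativeRing F using (_≈_; sym; reflexive; trans)
  open EvaluatingD using (d-undefined)
  open Decomposition.Trajectory r using (trajectory-j=1)

  D : ℕ → CommutativeRing.Carrier F
  D m = d F (suc (suc r)) s a (suc J) m (suc i)

  periodic : ∀ m → suc i ≤ m → D (m + suc r) ≈ D m
  periodic m n≤m with m≤n⇒∃[o]m+o≡n n≤m | n-range (suc (suc r)) J i n≤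
  ... | o , refl | inj₁ i≤ = ≡.subst (λ m → D (m + suc r) ≈ D m) (+-suc i o)
    (Periodicity.d-period F r isF p e pp 1≤e q≡p^e a s 1<s s<q J i i≤ o)
  -- j = 1, n = 2: b_2 is undefined, so both sides vanish.
  ... | o , refl | inj₂ (refl , refl) = trans (vanishes (suc o + suc r)) (sym (vanishes (suc o)))
    where
    vanishes : ∀ M → d F (suc (suc r)) s a 1 (suc M) 2 ≈ CommutativeRing.0# F
    vanishes M = reflexive (d-undefined F (suc (suc r)) s a 1 (suc M) 2 (trajectory-j=1 M))
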